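{- Let $h\geq 3$ be an integer. Let $A=\{0,a_2,\ldots,a_{h+1}\}$ be a set of nonnegative integers such that $0<a_2<\cdots<a_{h+1}$. Assume that $a_2\not\equiv 0\pmod 2$, $a_3=2a_2$, $a_4\equiv 0\pmod 2$ and $a_4\neq 4a_2$. Then \[ |h^{\wedge}_{\pm}A| \geq |(h-1)^{\wedge}_{\pm}A_1| + 2, \] where $A_1=A\setminus\{0\}$. Hence $|h^{\wedge}_{\pm}A|\geq h^2+2h-2$.
   Context: For a finite set $A=\{a_1,\ldots,a_k\}$ of integers and a positive integer $h$, the restricted $h$-fold signed sumset is $h^{\wedge}_{\pm}A=\left\{\sum_{i=1}^{k}\lambda_i a_i : \lambda_i\in\{ -1,0,1\} \text{ for all } i,\ \sum_{i=1}^{k}|\lambda_i| = h\right\}$. -}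

module Defs where

open import Data.Nat using (ℕ; zero; suc)
open import Data.Integer using (ℤ; +_; -_; _+_)
open import Data.Integer.Properties using (_≟_)
open import Data.List using (List; []; _∷_; [_]; _++_; map; length; deduplicate)

-- The restricted h-fold signed sumset of the list of integers A = [a₁,…,a_k],
-- as a list (possibly with repetitions) of all sums Σ λᵢ aᵢ with λᵢ ∈ {-1,0,1}
-- and exactly h nonzero λᵢ.
signedSumset : ℕ → List ℤ → List ℤ
signedSumset zero    _        = [ + 0 ]
signedSumset (suc h) []       = []
signedSumset (suc h) (a ∷ as) =
  signedSumset (suc h) as
  ++ map (λ s → a + s) (signedSumset h as)
  ++ map (λ s → (- a) + s) (signedSumset h as)

card : List ℤ → ℕ
card xs = length (deduplicate _≟_ xs)

module Submission where

-- An element of the h-fold signed sumset of {0} ∪ B, B = {b₀ < … < b_{h-1}} (b_i = a_{i+2}),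
-- either omits 0 or uses 0 and omits one b_j.  Using 0 once embeds the (h-1)-fold signed
-- sumset of B, and ±ΣB, which are larger in absolute value than all of its elements, give the
-- first bound.  For the second, s + ΣB is 2ΣS or b_j + 2ΣS for some S ⊆ B.  Twice the classical
-- h(h+1)/2 distinct subset sums of B, with b₂ and b₂ + 2b₀ inserted next to 2b₁ at each of the
-- h - 2 upper levels (possible as b₁ = 2b₀ and b₂ ≠ 2b₁ is even), and 0 give h(h+1)/2 + 2h - 3
-- distinct even values; omitting the odd b₀ gives 1 + h(h-1)/2 odd ones.

open import Defs
open import Data.Nat using (ℕ; zero; suc; _+_; _*_; _∸_; _≤_; _<_; _≥_; _≤′_; ≤′-reflexive; ≤′-step; z≤n; s≤s; s≤s⁻¹)
import Data.Nat.Properties as ℕP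
open import Algebra.Properties.CommutativeSemigroup ℕP.+-commutativeSemigroup using (x∙yz≈y∙xz)
open import Data.Nat.Divisibility using (_∣_; _∣0; ∣m∣n⇒∣m+n; ∣m+n∣m⇒∣n; m∣m*n)
open import Data.Nat.ListAction using (sum)
import Data.Nat.Tactic.RingSolver as ℕSolver
open import Data.Integer as ℤ using (ℤ; +_; ∣_∣)
import Data.Integer.Properties as ℤP
open import Algebra.Properties.AbelianGroup ℤP.+-0-abelianGroup using (∙-cancelʳ)
import Data.Integer.Tactic.RingSolver as ℤSolver
open import Data.List using (List; []; _∷_; [_]; _++_; _∷ʳ_; map; length; applyUpTo; upTo; deduplicate)
open import Data.List.Properties
  using (++-assoc; applyUpTo-∷ʳ; length-++; length-map; length-applyUpTo; length-removeAt′; map-upTo; map-applyUpTo)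
open import Data.List.Membership.Propositional using (_∈_)
open import Data.List.Membership.Propositional.Properties
  using (∈-++⁺ˡ; ∈-++⁺ʳ; ∈-++⁻; ∈-map⁺; ∈-map⁻; ∈-deduplicate⁺; ∈-deduplicate⁻)
open import Data.List.Relation.Binary.Subset.Propositional using (_⊆_)
open import Data.List.Relation.Binary.Disjoint.Propositional using (Disjoint)
open import Data.List.Relation.Unary.All as All using (All; []; _∷_)
import Data.List.Relation.Unary.All.Properties as All
open import Data.List.Relation.Unary.Any using (here; there; _─_)
open import Data.List.Relation.Unary.AllPairs using ([]; _∷_)
open import Data.List.Relation.Unary.Unique.Propositional using (Unique)
import Data.List.Relation.Unary.Unique.Propositional.Properties as Unique
open import Data.List.Relation.Unary.Unique.DecPropositional.Properties ℤP._≟_ using (deduplicate-!)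
open import Data.Empty using (⊥-elim)
open import Data.Product using (∃-syntax; _×_; _,_; proj₂)
open import Data.Sum using (_⊎_; inj₁; inj₂)
open import Function using (_∘_)
open import Relation.Nullary using (¬_)
open import Relation.Binary.Definitions using (tri<; tri≈; tri>)
open import Relation.Binary.PropositionalEquality hiding ([_])

private variable
  c j k m V W x y lo mid hi : ℕ
  L xs ys : List ℕ
  s : ℤ
  Z : List ℤ

∈-signedSumset-skip : ∀ {t} m → s ∈ signedSumset m Z → s ∈ signedSumset m (t ∷ Z)
∈-signedSumset-skip zero    s∈ = s∈
∈-signedSumset-skip (suc m) s∈ = ∈-++⁺ˡ s∈

∈-signedSumset-plus : ∀ {t} → s ∈ signedSumset m Z → t ℤ.+ s ∈ signedSumset (suc m) (t ∷ Z)
∈-signedSumset-plus {m = m} {Z = Z} s∈ = ∈-++⁺ʳ (signedSumset (suc m) Z) (∈-++⁺ˡ (∈-map⁺ _ s∈))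

∈-signedSumset-minus : ∀ {t} → s ∈ signedSumset m Z → ℤ.- t ℤ.+ s ∈ signedSumset (suc m) (t ∷ Z)
∈-signedSumset-minus {m = m} {Z = Z} {t} s∈ =
  ∈-++⁺ʳ (signedSumset (suc m) Z) (∈-++⁺ʳ (map (λ r → t ℤ.+ r) (signedSumset m Z)) (∈-map⁺ _ s∈))

∈-signedSumset-∷⁻ : ∀ {t} → s ∈ signedSumset (suc m) (t ∷ Z) →
  s ∈ signedSumset (suc m) Z ⊎ ∃[ r ] (r ∈ signedSumset m Z × ∣ s ∣ ≤ ∣ t ∣ + ∣ r ∣)
∈-signedSumset-∷⁻ {m = m} {Z = Z} {t} s∈ with ∈-++⁻ (signedSumset (suc m) Z) s∈
... | inj₁ s∈′ = inj₁ s∈′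
... | inj₂ s∈′ with ∈-++⁻ (map (λ r → t ℤ.+ r) (signedSumset m Z)) s∈′
... | inj₁ s∈⁺ with r , r∈ , refl ← ∈-map⁻ _ s∈⁺ = inj₂ (r , r∈ , ℤP.∣i+j∣≤∣i∣+∣j∣ t r)
... | inj₂ s∈⁻ with r , r∈ , refl ← ∈-map⁻ _ s∈⁻ =
  inj₂ (r , r∈ , subst (λ u → ∣ ℤ.- t ℤ.+ r ∣ ≤ u + ∣ r ∣) (ℤP.∣-i∣≡∣i∣ t) (ℤP.∣i+j∣≤∣i∣+∣j∣ (ℤ.- t) r))

signedSumset-∣∣≤sum : ∀ m L → s ∈ signedSumset m (map +_ L) → ∣ s ∣ ≤ sum L
signedSumset-∣∣≤sum zero    L       (here refl) = z≤n
signedSumset-∣∣≤sum (suc m) (x ∷ L) s∈ with ∈-signedSumset-∷⁻ {Z = map +_ L} {t = + x} s∈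
... | inj₁ s∈′            = ℕP.≤-trans (signedSumset-∣∣≤sum (suc m) L s∈′) (ℕP.m≤n+m (sum L) x)
... | inj₂ (r , r∈ , s≤) = ℕP.≤-trans s≤ (ℕP.+-monoʳ-≤ x (signedSumset-∣∣≤sum m L r∈))

-- Fewer terms than elements: some positive element is left out.
signedSumset-∣∣<sum : ∀ m L → All (0 <_) L → m < length L → s ∈ signedSumset m (map +_ L) → ∣ s ∣ < sum L
signedSumset-∣∣<sum zero    (x ∷ L) (x>0 ∷ _) _ (here refl) = ℕP.<-≤-trans x>0 (ℕP.m≤m+n x (sum L))
signedSumset-∣∣<sum (suc m) (x ∷ L) (x>0 ∷ L>0) (s≤s m<) s∈ with ∈-signedSumset-∷⁻ {Z = map +_ L} {t = + x} s∈
... | inj₁ s∈′            = ℕP.≤-<-trans (signedSumset-∣∣≤sum (suc m) L s∈′) (ℕP.m<n+m (sum L) x>0)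
... | inj₂ (r , r∈ , s≤) = ℕP.≤-<-trans s≤ (ℕP.+-monoʳ-< x (signedSumset-∣∣<sum m L L>0 m< r∈))

module _ {A : Set} where

  ∈-─ : ∀ {x z : A} {ys} (x∈ys : x ∈ ys) → z ∈ ys → z ≢ x → z ∈ (ys ─ x∈ys)
  ∈-─ (here refl)  (here refl)  z≢x = ⊥-elim (z≢x refl)
  ∈-─ (here refl)  (there z∈ys) _   = z∈ys
  ∈-─ (there x∈ys) (here refl)  _   = here refl
  ∈-─ (there x∈ys) (there z∈ys) z≢x = there (∈-─ x∈ys z∈ys z≢x)

  Unique⇒length≤ : ∀ {xs ys : List A} → Unique xs → xs ⊆ ys → length xs ≤ length ys
  Unique⇒length≤ {[]}     _              _      = z≤n
  Unique⇒length≤ {x ∷ xs} {ys} (x∉xs ∷ u) xs⊆ys =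
    subst (suc (length xs) ≤_) (sym (length-removeAt′ ys _))
      (s≤s (Unique⇒length≤ u (λ z∈xs → ∈-─ x∈ys (xs⊆ys (there z∈xs)) (λ z≡x → All.lookup x∉xs z∈xs (sym z≡x)))))
    where
    x∈ys : x ∈ ys
    x∈ys = xs⊆ys (here refl)

Unique⇒length≤card : ∀ {xs S} → Unique xs → xs ⊆ S → length xs ≤ card S
Unique⇒length≤card u xs⊆S = Unique⇒length≤ u (∈-deduplicate⁺ ℤP._≟_ ∘ xs⊆S)

-- SignedSum m L W: W = ΣL + s for a signed sum s of m elements of L, each element x
-- adding 0 (minus), 2x (plus) or x (skipped) to W.  Keeping W in ℕ makes the values
-- easy to order and their parity easy to read off.
data Sign (x : ℕ) : ℕ → ℕ → Set where
  minus : Sign x 1 0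
  plus  : Sign x 1 (2 * x)
  skip  : Sign x 0 x

data SignedSum : ℕ → List ℕ → ℕ → Set where
  []  : SignedSum 0 [] 0
  _∷_ : Sign x c V → SignedSum m L W → SignedSum (c + m) (x ∷ L) (V + W)

signedValue : List ℕ → ℕ → ℤ
signedValue L W = + W ℤ.- + sum L

signedValue-∷ : ∀ x L V W → signedValue (x ∷ L) (V + W) ≡ (+ V ℤ.- + x) ℤ.+ signedValue L W
signedValue-∷ x L V W = begin
  + (V + W) ℤ.- + (x + sum L)             ≡⟨ cong₂ ℤ._-_ (ℤP.pos-+ V W) (ℤP.pos-+ x (sum L)) ⟩
  (+ V ℤ.+ + W) ℤ.- (+ x ℤ.+ + sum L)     ≡⟨ regroup (+ V) (+ W) (+ x) (+ sum L) ⟩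
  (+ V ℤ.- + x) ℤ.+ (+ W ℤ.- + sum L)     ∎
  where
  open ≡-Reasoning
  regroup : ∀ v w t u → (v ℤ.+ w) ℤ.- (t ℤ.+ u) ≡ (v ℤ.- t) ℤ.+ (w ℤ.- u)
  regroup = ℤSolver.solve-∀

twice-minus-once : ∀ x → + (2 * x) ℤ.- + x ≡ + x
twice-minus-once x = begin
  + (x + (x + 0)) ℤ.- + x     ≡⟨ cong (λ u → + (x + u) ℤ.- + x) (ℕP.+-identityʳ x) ⟩
  + (x + x) ℤ.- + x           ≡⟨ cong (ℤ._- + x) (ℤP.pos-+ x x) ⟩
  (+ x ℤ.+ + x) ℤ.- + x       ≡⟨ cancel (+ x) ⟩
  + x                         ∎
  where
  open ≡-Reasoning
  cancel : ∀ t → (t ℤ.+ t) ℤ.- t ≡ t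
  cancel = ℤSolver.solve-∀

Sign-∈ : ∀ {x} → Sign x c V → s ∈ signedSumset m Z →
         (+ V ℤ.- + x) ℤ.+ s ∈ signedSumset (c + m) (+ x ∷ Z)
Sign-∈ {s = s} {m = m} {Z = Z} {x = x} minus s∈ =
  subst (_∈ _) (cong (ℤ._+ s) (sym (ℤP.+-identityˡ (ℤ.- + x)))) (∈-signedSumset-minus {m = m} {Z = Z} {t = + x} s∈)
Sign-∈ {s = s} {m = m} {Z = Z} {x = x} plus  s∈ =
  subst (_∈ _) (cong (ℤ._+ s) (sym (twice-minus-once x))) (∈-signedSumset-plus {m = m} {Z = Z} {t = + x} s∈)
Sign-∈ {s = s} {m = m} {Z = Z} {x = x} skip  s∈ =
  subst (_∈ _) (trans (sym (ℤP.+-identityˡ s)) (cong (ℤ._+ s) (sym (ℤP.+-inverseʳ (+ x)))))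
    (∈-signedSumset-skip {Z = Z} {t = + x} m s∈)

SignedSum⇒∈ : SignedSum m L W → signedValue L W ∈ signedSumset m (map +_ L)
SignedSum⇒∈ []                                = here refl
SignedSum⇒∈ (_∷_ {x = x} {V = V} {L = L} {W = W} σ p) =
  subst (_∈ _) (sym (signedValue-∷ x L V W)) (Sign-∈ σ (SignedSum⇒∈ p))

minus-all : ∀ L → SignedSum (length L) L 0
minus-all []      = []
minus-all (x ∷ L) = minus ∷ minus-all L

plus-all : ∀ L → SignedSum (length L) L (2 * sum L)
plus-all []      = []
plus-all (x ∷ L) = subst (SignedSum _ (x ∷ L)) (sym (ℕP.*-distribˡ-+ 2 x (sum L))) (plus ∷ plus-all L)

signedValue-injective : ∀ L {W W′} → signedValue L W ≡ signedValue L W′ → W ≡ W′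
signedValue-injective L {W} {W′} eq = ℤP.+-injective (∙-cancelʳ (ℤ.- + sum L) (+ W) (+ W′) eq)

SignedSums≤card : ∀ {Ws} → Unique Ws → All (SignedSum m L) Ws → length Ws ≤ card (signedSumset m (map +_ L))
SignedSums≤card {L = L} {Ws} u Ws∈ = subst (_≤ _) (length-map (signedValue L) Ws)
  (Unique⇒length≤card (Unique.map⁺ (signedValue-injective L) u) ⊆signedSumset)
  where
  ⊆signedSumset : map (signedValue L) Ws ⊆ _
  ⊆signedSumset z∈ with W , W∈ , refl ← ∈-map⁻ (signedValue L) z∈ = SignedSum⇒∈ (All.lookup Ws∈ W∈)

+≢-+ : 0 < x → + x ≢ ℤ.- + x
+≢-+ {suc x} _ ()

card-signedSumset-∷-zero : ∀ L k → All (0 <_) L → length L ≡ suc k →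
  card (signedSumset (suc k) (+ 0 ∷ map +_ L)) ≥ card (signedSumset k (map +_ L)) + 2
card-signedSumset-∷-zero []            k _                   ()
card-signedSumset-∷-zero L@(x ∷ L′) k L>0@(x>0 ∷ _) |L|≡1+k =
  subst (_≤ card S) (ℕP.+-comm 2 (card S⁻)) (Unique⇒length≤card unique ⊆S)
  where
  M : ℕ
  M = sum L

  S S⁻ D : List ℤ
  S  = signedSumset (suc k) (+ 0 ∷ map +_ L)
  S⁻ = signedSumset k (map +_ L)
  D  = deduplicate ℤP._≟_ S⁻

  M>0 : 0 < M
  M>0 = ℕP.<-≤-trans x>0 (ℕP.m≤m+n x (sum L′))

  D<M : ∀ {z} → z ∈ D → ∣ z ∣ < M
  D<M z∈D = signedSumset-∣∣<sum k L L>0 (subst (k <_) (sym |L|≡1+k) ℕP.≤-refl) (∈-deduplicate⁻ ℤP._≟_ S⁻ z∈D)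

  unique : Unique (+ M ∷ ℤ.- + M ∷ D)
  unique = (+≢-+ M>0 ∷ All.tabulate (λ z∈D eq → ℕP.<⇒≢ (D<M z∈D) (sym (cong ∣_∣ eq))))
         ∷ All.tabulate (λ z∈D eq → ℕP.<⇒≢ (D<M z∈D) (trans (sym (cong ∣_∣ eq)) (ℤP.∣-i∣≡∣i∣ (+ M))))
         ∷ deduplicate-! S⁻

  ∈S : ∀ {W} → SignedSum (length L) (0 ∷ L) W → signedValue L W ∈ S
  ∈S {W} p = subst (λ h → signedValue L W ∈ signedSumset h (+ 0 ∷ map +_ L)) |L|≡1+k (SignedSum⇒∈ p)

  ⊆S : (+ M ∷ ℤ.- + M ∷ D) ⊆ S
  ⊆S (here refl)         = subst (_∈ S) (twice-minus-once M) (∈S (skip ∷ plus-all L))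
  ⊆S (there (here refl)) = subst (_∈ S) (ℤP.+-identityˡ (ℤ.- + M)) (∈S (skip ∷ minus-all L))
  ⊆S (there (there z∈D)) =
    subst (_∈ S) (ℤP.+-identityˡ _)
      (∈-signedSumset-plus {m = k} {Z = map +_ L} {t = + 0} (∈-deduplicate⁻ ℤP._≟_ S⁻ z∈D))

SignedSum-∷ʳ : SignedSum m L W → Sign y c V → SignedSum (c + m) (L ∷ʳ y) (V + W)
SignedSum-∷ʳ []                           σ = σ ∷ []
SignedSum-∷ʳ {y = y} {c = c} {V = V} (_∷_ {x = x} {c = c′} {V = V′} {m = m} {L = L} {W = W} σ′ p) σ =
  subst₂ (λ k U → SignedSum k (x ∷ L ∷ʳ y) U) (x∙yz≈y∙xz c′ c m) (x∙yz≈y∙xz V′ V W) (σ′ ∷ SignedSum-∷ʳ p σ)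

SignedPrefixSum : List ℕ → (ℕ → ℕ) → ℕ → ℕ → Set
SignedPrefixSum P g j W = SignedSum j (P ++ applyUpTo g j) W

module _ (P : List ℕ) (g : ℕ → ℕ) where

  SignedPrefixSum-extend : SignedPrefixSum P g j W → Sign (g j) c V →
                           SignedSum (c + j) (P ++ applyUpTo g (suc j)) (V + W)
  SignedPrefixSum-extend {j = j} p σ =
    subst (λ L → SignedSum _ L _) (trans (++-assoc P (applyUpTo g j) [ g j ]) (cong (P ++_) (applyUpTo-∷ʳ g j)))
      (SignedSum-∷ʳ p σ)

  SignedPrefixSum-plus : SignedPrefixSum P g j W → SignedPrefixSum P g (suc j) (2 * g j + W)
  SignedPrefixSum-plus p = SignedPrefixSum-extend p plus

  SignedPrefixSum-≤′ : j ≤′ k → SignedPrefixSum P g j W → SignedPrefixSum P g k W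
  SignedPrefixSum-≤′ (≤′-reflexive refl) p = p
  SignedPrefixSum-≤′ (≤′-step j≤′k)       p = SignedPrefixSum-extend (SignedPrefixSum-≤′ j≤′k p) minus

  SignedPrefixSum-≤ : j ≤ k → SignedPrefixSum P g j W → SignedPrefixSum P g k W
  SignedPrefixSum-≤ = SignedPrefixSum-≤′ ∘ ℕP.≤⇒≤′

Full : (ℕ → ℕ) → ℕ → ℕ → Set
Full = SignedPrefixSum []

WithZero : (ℕ → ℕ) → ℕ → ℕ → Set
WithZero = SignedPrefixSum [ 0 ]

module _ (g : ℕ → ℕ) where

  Full-zero : Full g j 0
  Full-zero = SignedPrefixSum-≤ [] g z≤n []

  Full⇒WithZero : Full g j W → WithZero g j W
  Full⇒WithZero p = skip ∷ p

  Full-skip-next : Full g j W → WithZero g (suc j) (g j + W)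
  Full-skip-next p = plus ∷ SignedPrefixSum-extend [] g p skip

  Full-skip-first : Full (g ∘ suc) j W → WithZero g (suc j) (g 0 + W)
  Full-skip-first p = plus ∷ (skip ∷ p)

  Full-singleton : ∀ i → Full g (suc i) (2 * g i + 0)
  Full-singleton i = SignedPrefixSum-plus [] g (Full-zero {j = i})

data Ascending : ℕ → List ℕ → ℕ → Set where
  []  : Ascending lo [] lo
  _∷_ : lo < x → Ascending x xs hi → Ascending lo (x ∷ xs) hi

Ascending-++ : Ascending lo xs mid → Ascending mid ys hi → Ascending lo (xs ++ ys) hi
Ascending-++ []           ys↑ = ys↑
Ascending-++ (lo<x ∷ xs↑) ys↑ = lo<x ∷ Ascending-++ xs↑ ys↑

shift : ℕ → List ℕ → List ℕ
shift d = map (λ w → d + w)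

Ascending-shift : ∀ d → Ascending lo xs hi → Ascending (d + lo) (shift d xs) (d + hi)
Ascending-shift d []           = []
Ascending-shift d (lo<x ∷ xs↑) = ℕP.+-monoʳ-< d lo<x ∷ Ascending-shift d xs↑

Ascending-applyUpTo : ∀ (f : ℕ → ℕ) n → lo < f 0 → (∀ {i} → i < n → f i < f (suc i)) →
                      Ascending lo (applyUpTo f (suc n)) (f n)
Ascending-applyUpTo f zero    lo<f₀ f↑ = lo<f₀ ∷ []
Ascending-applyUpTo f (suc n) lo<f₀ f↑ =
  lo<f₀ ∷ Ascending-applyUpTo (f ∘ suc) n (f↑ (s≤s z≤n)) (f↑ ∘ s≤s)

Ascending⇒All> : Ascending lo xs hi → All (lo <_) xs
Ascending⇒All> []           = []
Ascending⇒All> (lo<x ∷ xs↑) = lo<x ∷ All.map (ℕP.<-trans lo<x) (Ascending⇒All> xs↑)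

Ascending⇒Unique : Ascending lo xs hi → Unique (lo ∷ xs)
Ascending⇒Unique []              = [] ∷ []
Ascending⇒Unique xs↑@(_ ∷ xs′↑) = All.map ℕP.<⇒≢ (Ascending⇒All> xs↑) ∷ Ascending⇒Unique xs′↑

IncreasingBelow : (ℕ → ℕ) → ℕ → Set
IncreasingBelow g m = ∀ {i} → suc i < m → g i < g (suc i)

IncreasingBelow-positive : ∀ {g} → 0 < g 0 → IncreasingBelow g m → ∀ {i} → i < m → 0 < g i
IncreasingBelow-positive g₀>0 g↑ {zero}  _     = g₀>0
IncreasingBelow-positive g₀>0 g↑ {suc i} 1+i<m =
  ℕP.<-trans (IncreasingBelow-positive g₀>0 g↑ (ℕP.<-trans (ℕP.n<1+n i) 1+i<m)) (g↑ 1+i<m)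

triangle : ℕ → ℕ
triangle zero    = 0
triangle (suc m) = suc m + triangle m

triangle-suc+triangle : ∀ m → triangle (suc m) + triangle m ≡ suc m * suc m
triangle-suc+triangle zero    = refl
triangle-suc+triangle (suc m) = begin
  (2 + m + triangle (suc m)) + (suc m + triangle m)   ≡⟨ shuffle (2 + m) (suc m) (triangle (suc m)) (triangle m) ⟩
  (2 + m + suc m) + (triangle (suc m) + triangle m)   ≡⟨ cong (_+_ (2 + m + suc m)) (triangle-suc+triangle m) ⟩
  (2 + m + suc m) + suc m * suc m                     ≡⟨ square-suc m ⟩
  (2 + m) * (2 + m)                                   ∎
  where
  open ≡-Reasoning
  shuffle : ∀ a b t u → (a + t) + (b + u) ≡ (a + b) + (t + u)
  shuffle = ℕSolver.solve-∀
  square-suc : ∀ m → (2 + m + suc m) + suc m * suc m ≡ (2 + m) * (2 + m)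
  square-suc = ℕSolver.solve-∀

doubles : (ℕ → ℕ) → ℕ → List ℕ
doubles g = applyUpTo (λ i → 2 * g i + 0)

module _ (g : ℕ → ℕ) where

  doubles-length : ∀ m → length (doubles g m) ≡ m
  doubles-length = length-applyUpTo _

  doubles-even : ∀ m → All (2 ∣_) (doubles g m)
  doubles-even m = All.applyUpTo⁺₁ (λ i → 2 * g i + 0) m (λ {i} _ → ∣m∣n⇒∣m+n (m∣m*n (g i)) (2 ∣0))

  doubles-ascending : ∀ n → lo < 2 * g 0 + 0 → (∀ {i} → i < n → g i < g (suc i)) →
                      Ascending lo (doubles g (suc n)) (2 * g n + 0)
  doubles-ascending n lo<2g₀ g↑ = Ascending-applyUpTo _ n lo<2g₀ (double-< ∘ g↑)
    where
    double-< : x < y → 2 * x + 0 < 2 * y + 0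
    double-< = ℕP.+-monoˡ-< 0 ∘ ℕP.*-monoʳ-< 2

doubles-Full : ∀ g k m → All (Full g (k + m)) (doubles (λ i → g (k + i)) m)
doubles-Full g k m =
  All.applyUpTo⁺₁ _ m (λ i<m → SignedPrefixSum-≤ [] g (ℕP.+-monoʳ-< k i<m) (Full-singleton g _))

-- Twice the classical m(m+1)/2 distinct subset sums of g 0 < … < g (m-1).
twiceSubsetSums : (ℕ → ℕ) → ℕ → List ℕ
twiceSubsetSums g zero    = []
twiceSubsetSums g (suc m) = doubles g (suc m) ++ shift (2 * g m) (twiceSubsetSums g m)

module _ (g : ℕ → ℕ) where

  twiceSubsetSums-Full : ∀ m → All (Full g m) (twiceSubsetSums g m)
  twiceSubsetSums-Full zero    = []
  twiceSubsetSums-Full (suc m) =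
    All.++⁺ (doubles-Full g 0 (suc m)) (All.map⁺ (All.map (SignedPrefixSum-plus [] g) (twiceSubsetSums-Full m)))

  twiceSubsetSums-even : ∀ m → All (2 ∣_) (twiceSubsetSums g m)
  twiceSubsetSums-even zero    = []
  twiceSubsetSums-even (suc m) =
    All.++⁺ (doubles-even g (suc m)) (All.map⁺ (All.map (∣m∣n⇒∣m+n (m∣m*n (g m))) (twiceSubsetSums-even m)))

  twiceSubsetSums-length : ∀ m → length (twiceSubsetSums g m) ≡ triangle m
  twiceSubsetSums-length zero    = refl
  twiceSubsetSums-length (suc m) = begin
    length (doubles g (suc m) ++ shift (2 * g m) (twiceSubsetSums g m))
      ≡⟨ length-++ (doubles g (suc m)) ⟩
    length (doubles g (suc m)) + length (shift (2 * g m) (twiceSubsetSums g m))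
      ≡⟨ cong₂ _+_ (doubles-length g (suc m)) (length-map _ (twiceSubsetSums g m)) ⟩
    suc m + length (twiceSubsetSums g m)
      ≡⟨ cong (_+_ (suc m)) (twiceSubsetSums-length m) ⟩
    suc m + triangle m
      ∎
    where open ≡-Reasoning

  twiceSubsetSums-ascending : 0 < g 0 → ∀ m → IncreasingBelow g m → ∃[ hi ] Ascending 0 (twiceSubsetSums g m) hi
  twiceSubsetSums-ascending g₀>0 zero    _  = 0 , []
  twiceSubsetSums-ascending g₀>0 (suc m) g↑ =
    let hi , ↑ = twiceSubsetSums-ascending g₀>0 m (g↑ ∘ ℕP.m<n⇒m<1+n) in
    2 * g m + hi ,
    Ascending-++ (doubles-ascending g m (ℕP.+-monoˡ-< 0 (ℕP.*-monoʳ-< 2 g₀>0)) (g↑ ∘ s≤s))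
                 (Ascending-shift (2 * g m) ↑)

record Interpolation (b : ℕ → ℕ) : Set where
  field
    points    : List ℕ
    length≡3  : length points ≡ 3
    members   : All (WithZero b 3) points
    ascending : Ascending (2 * b 0 + 0) points (b 2 + (2 * b 0 + 0))
    even      : All (2 ∣_) points

module _ (b : ℕ → ℕ) where

  skip-b₂ : WithZero b 3 (b 2 + 0)
  skip-b₂ = Full-skip-next b (Full-zero b)

  double-b₁ : WithZero b 3 (2 * b 1 + 0)
  double-b₁ = Full⇒WithZero b (SignedPrefixSum-≤ [] b (ℕP.n≤1+n 2) (Full-singleton b 1))

  skip-b₂-double-b₀ : WithZero b 3 (b 2 + (2 * b 0 + 0))
  skip-b₂-double-b₀ = Full-skip-next b (SignedPrefixSum-≤ [] b (ℕP.n≤1+n 1) (Full-singleton b 0))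

module _ (b : ℕ → ℕ) (b₀>0 : 0 < b 0) (b₁≡2b₀ : b 1 ≡ 2 * b 0) (b₁<b₂ : b 1 < b 2) (2∣b₂ : 2 ∣ b 2) where

  private
    2b₀<b₂ : 2 * b 0 < b 2
    2b₀<b₂ = subst (_< b 2) b₁≡2b₀ b₁<b₂

    b₀<b₁ : b 0 < b 1
    b₀<b₁ = subst (b 0 <_) (sym b₁≡2b₀) (ℕP.m<m+n (b 0) (ℕP.+-monoˡ-< 0 b₀>0))

    2b₁<b₂+2b₀ : 2 * b 1 + 0 < b 2 + (2 * b 0 + 0)
    2b₁<b₂+2b₀ = subst (_< b 2 + (2 * b 0 + 0)) (sym 2b₁≡2b₀+2b₀) (ℕP.+-monoˡ-< (2 * b 0 + 0) 2b₀<b₂)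
      where
      double-double : ∀ x → 2 * (2 * x) + 0 ≡ 2 * x + (2 * x + 0)
      double-double = ℕSolver.solve-∀
      2b₁≡2b₀+2b₀ : 2 * b 1 + 0 ≡ 2 * b 0 + (2 * b 0 + 0)
      2b₁≡2b₀+2b₀ = trans (cong (λ t → 2 * t + 0) b₁≡2b₀) (double-double (b 0))

    b₂<b₂+2b₀ : b 2 + 0 < b 2 + (2 * b 0 + 0)
    b₂<b₂+2b₀ = ℕP.+-monoʳ-< (b 2) (ℕP.+-monoˡ-< 0 (ℕP.*-monoʳ-< 2 b₀>0))

    even-b₂ : 2 ∣ b 2 + 0
    even-b₂ = ∣m∣n⇒∣m+n 2∣b₂ (2 ∣0)

    even-2b₁ : 2 ∣ 2 * b 1 + 0
    even-2b₁ = ∣m∣n⇒∣m+n (m∣m*n (b 1)) (2 ∣0)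

    even-b₂+2b₀ : 2 ∣ b 2 + (2 * b 0 + 0)
    even-b₂+2b₀ = ∣m∣n⇒∣m+n 2∣b₂ (∣m∣n⇒∣m+n (m∣m*n (b 0)) (2 ∣0))

  interpolation : b 2 ≢ 2 * b 1 → Interpolation b
  interpolation b₂≢2b₁ with ℕP.<-cmp (b 2) (2 * b 1)
  ... | tri< b₂<2b₁ _ _ = record
    { points    = b 2 + 0 ∷ 2 * b 1 + 0 ∷ b 2 + (2 * b 0 + 0) ∷ []
    ; length≡3  = refl
    ; members   = skip-b₂ b ∷ double-b₁ b ∷ skip-b₂-double-b₀ b ∷ []
    ; ascending = ℕP.+-monoˡ-< 0 2b₀<b₂ ∷ ℕP.+-monoˡ-< 0 b₂<2b₁ ∷ 2b₁<b₂+2b₀ ∷ []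
    ; even      = even-b₂ ∷ even-2b₁ ∷ even-b₂+2b₀ ∷ []
    }
  ... | tri≈ _ b₂≡2b₁ _ = ⊥-elim (b₂≢2b₁ b₂≡2b₁)
  ... | tri> _ _ 2b₁<b₂ = record
    { points    = 2 * b 1 + 0 ∷ b 2 + 0 ∷ b 2 + (2 * b 0 + 0) ∷ []
    ; length≡3  = refl
    ; members   = double-b₁ b ∷ skip-b₂ b ∷ skip-b₂-double-b₀ b ∷ []
    ; ascending = ℕP.+-monoˡ-< 0 (ℕP.*-monoʳ-< 2 b₀<b₁) ∷ ℕP.+-monoˡ-< 0 2b₁<b₂ ∷ b₂<b₂+2b₀ ∷ []
    ; even      = even-2b₁ ∷ even-b₂ ∷ even-b₂+2b₀ ∷ []
    }

-- chain n is twiceSubsetSums b (2 + n) in which, on every level above the second, the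
-- double 2b₁ is replaced by the three interpolation points: two extra values per level.
module Chain (b : ℕ → ℕ) (I : Interpolation b) where
  open Interpolation I

  chain : ℕ → List ℕ
  chain zero    = twiceSubsetSums b 2
  chain (suc n) = 2 * b 0 + 0 ∷ points ++ doubles (λ i → b (2 + i)) (suc n) ++ shift (2 * b (2 + n)) (chain n)

  chain-WithZero : ∀ n → All (WithZero b (2 + n)) (chain n)
  chain-WithZero zero    = All.map (Full⇒WithZero b) (twiceSubsetSums-Full b 2)
  chain-WithZero (suc n) =
    SignedPrefixSum-≤ [ 0 ] b (s≤s z≤n) (Full⇒WithZero b (Full-singleton b 0)) ∷
    All.++⁺ (All.map (SignedPrefixSum-≤ [ 0 ] b (ℕP.m≤m+n 3 n)) members)
      (All.++⁺ (All.map (Full⇒WithZero b) (doubles-Full b 2 (suc n)))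
        (All.map⁺ (All.map (SignedPrefixSum-plus [ 0 ] b) (chain-WithZero n))))

  chain-even : ∀ n → All (2 ∣_) (chain n)
  chain-even zero    = twiceSubsetSums-even b 2
  chain-even (suc n) = ∣m∣n⇒∣m+n (m∣m*n (b 0)) (2 ∣0) ∷
    All.++⁺ even (All.++⁺ (doubles-even (λ i → b (2 + i)) (suc n))
      (All.map⁺ (All.map (∣m∣n⇒∣m+n (m∣m*n (b (2 + n)))) (chain-even n))))

  chain-length : ∀ n → length (chain n) ≡ triangle (2 + n) + 2 * n
  chain-length zero    = refl
  chain-length (suc n) = begin
    suc (length (points ++ ds ++ shift _ (chain n)))
      ≡⟨ cong suc (length-++ points) ⟩
    suc (length points + length (ds ++ shift _ (chain n)))
      ≡⟨ cong (λ t → suc (length points + t)) (length-++ ds) ⟩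
    suc (length points + (length ds + length (shift _ (chain n))))
      ≡⟨ cong₂ (λ t u → suc (t + u)) length≡3
               (cong₂ _+_ (doubles-length (λ i → b (2 + i)) (suc n)) (length-map _ (chain n))) ⟩
    suc (3 + (suc n + length (chain n)))
      ≡⟨ cong (λ t → suc (3 + (suc n + t))) (chain-length n) ⟩
    suc (3 + (suc n + (triangle (2 + n) + 2 * n)))
      ≡⟨ arithmetic n (triangle (2 + n)) ⟩
    triangle (3 + n) + 2 * suc n
      ∎
    where
    open ≡-Reasoning
    ds : List ℕ
    ds = doubles (λ i → b (2 + i)) (suc n)
    arithmetic : ∀ n t → suc (3 + (suc n + (t + 2 * n))) ≡ (3 + n + t) + 2 * suc n
    arithmetic = ℕSolver.solve-∀

  chain-ascending : 0 < b 0 → 2 * b 0 < b 2 → ∀ n → IncreasingBelow b (2 + n) → ∃[ hi ] Ascending 0 (chain n) hi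
  chain-ascending b₀>0 _      zero    b↑ = twiceSubsetSums-ascending b b₀>0 2 b↑
  chain-ascending b₀>0 2b₀<b₂ (suc n) b↑ =
    let hi , ↑ = chain-ascending b₀>0 2b₀<b₂ n (b↑ ∘ ℕP.m<n⇒m<1+n) in
    2 * b (2 + n) + hi ,
    ℕP.+-monoˡ-< 0 (ℕP.*-monoʳ-< 2 b₀>0) ∷
    Ascending-++ ascending (Ascending-++ (doubles-ascending (λ i → b (2 + i)) n b₂+2b₀<2b₂ (b↑ ∘ s≤s ∘ s≤s ∘ s≤s))
                                         (Ascending-shift (2 * b (2 + n)) ↑))
    where
    b₂+2b₀<2b₂ : b 2 + (2 * b 0 + 0) < 2 * b 2 + 0
    b₂+2b₀<2b₂ = subst (b 2 + (2 * b 0 + 0) <_) (sym (ℕP.+-identityʳ (2 * b 2)))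
                       (ℕP.+-monoʳ-< (b 2) (ℕP.+-monoˡ-< 0 2b₀<b₂))

card-signedSumset≥square : ∀ b n → 0 < b 0 → IncreasingBelow b (3 + n) →
  ¬ 2 ∣ b 0 → b 1 ≡ 2 * b 0 → 2 ∣ b 2 → b 2 ≢ 2 * b 1 →
  card (signedSumset (3 + n) (+ 0 ∷ map +_ (applyUpTo b (3 + n)))) ≥ (3 + n) * (3 + n) + 2 * (3 + n) ∸ 2
card-signedSumset≥square b n b₀>0 b↑ b₀-odd b₁≡2b₀ 2∣b₂ b₂≢2b₁ =
  subst (_≤ card (signedSumset (3 + n) (+ 0 ∷ map +_ (applyUpTo b (3 + n))))) count
    (SignedSums≤card {L = 0 ∷ applyUpTo b (3 + n)} (Unique.++⁺ evens-unique odds-unique disjoint)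
                     (All.++⁺ evens-member odds-member))
  where
  b₁<b₂ : b 1 < b 2
  b₁<b₂ = b↑ (s≤s (s≤s (s≤s z≤n)))

  open Chain b (interpolation b b₀>0 b₁≡2b₀ b₁<b₂ 2∣b₂ b₂≢2b₁)

  evens odds : List ℕ
  evens = 0 ∷ chain (suc n)
  odds  = shift (b 0) (0 ∷ twiceSubsetSums (b ∘ suc) (2 + n))

  evens-unique : Unique evens
  evens-unique = Ascending⇒Unique (proj₂ (chain-ascending b₀>0 (subst (_< b 2) b₁≡2b₀ b₁<b₂) (suc n) b↑))

  odds-unique : Unique odds
  odds-unique = Unique.map⁺ (ℕP.+-cancelˡ-≡ (b 0) _ _)
    (Ascending⇒Unique (proj₂ (twiceSubsetSums-ascending (b ∘ suc) b₁>0 (2 + n) (b↑ ∘ s≤s))))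
    where
    b₁>0 : 0 < b 1
    b₁>0 = IncreasingBelow-positive b₀>0 b↑ (s≤s (s≤s z≤n))

  disjoint : Disjoint evens odds
  disjoint (w∈evens , w∈odds) = All.lookup odds-odd w∈odds (All.lookup evens-even w∈evens)
    where
    evens-even : All (2 ∣_) evens
    evens-even = (2 ∣0) ∷ chain-even (suc n)
    odds-odd : All (¬_ ∘ (2 ∣_)) odds
    odds-odd = All.map⁺ (All.map b₀+even-odd ((2 ∣0) ∷ twiceSubsetSums-even (b ∘ suc) (2 + n)))
      where
      b₀+even-odd : ∀ {w} → 2 ∣ w → ¬ 2 ∣ b 0 + w
      b₀+even-odd {w} 2∣w 2∣b₀+w = b₀-odd (∣m+n∣m⇒∣n (subst (2 ∣_) (ℕP.+-comm (b 0) w) 2∣b₀+w) 2∣w)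

  evens-member : All (WithZero b (3 + n)) evens
  evens-member = Full⇒WithZero b (Full-zero b) ∷ chain-WithZero (suc n)

  odds-member : All (WithZero b (3 + n)) odds
  odds-member =
    All.map⁺ (All.map (Full-skip-first b) (Full-zero (b ∘ suc) ∷ twiceSubsetSums-Full (b ∘ suc) (2 + n)))

  count : length (evens ++ odds) ≡ (3 + n) * (3 + n) + 2 * (3 + n) ∸ 2
  count = begin
    length (evens ++ odds)
      ≡⟨ length-++ evens ⟩
    suc (length (chain (suc n))) + length odds
      ≡⟨ cong₂ (λ t u → suc t + u) (chain-length (suc n)) odds-length ⟩
    suc (t₃ + 2 * suc n) + suc t₂
      ≡⟨ sym (ℕP.m+n∸n≡m _ 2) ⟩
    suc (t₃ + 2 * suc n) + suc t₂ + 2 ∸ 2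
      ≡⟨ cong (_∸ 2) (arithmetic n t₃ t₂) ⟩
    (t₃ + t₂) + 2 * (3 + n) ∸ 2
      ≡⟨ cong (λ t → t + 2 * (3 + n) ∸ 2) (triangle-suc+triangle (2 + n)) ⟩
    (3 + n) * (3 + n) + 2 * (3 + n) ∸ 2
      ∎
    where
    open ≡-Reasoning
    t₃ t₂ : ℕ
    t₃ = triangle (3 + n)
    t₂ = triangle (2 + n)
    odds-length : length odds ≡ suc t₂
    odds-length = trans (length-map _ (0 ∷ twiceSubsetSums (b ∘ suc) (2 + n)))
                        (cong suc (twiceSubsetSums-length (b ∘ suc) (2 + n)))
    arithmetic : ∀ n t₃ t₂ → suc (t₃ + 2 * suc n) + suc t₂ + 2 ≡ (t₃ + t₂) + 2 * (3 + n)
    arithmetic = ℕSolver.solve-∀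

lemma2p10 : (h : ℕ) → 3 ≤ h → (a : ℕ → ℕ) →
    0 < a 2 →
    (∀ i → 2 ≤ i → i < h + 1 → a i < a (1 + i)) →
    ¬ (2 ∣ a 2) → a 3 ≡ 2 * a 2 → 2 ∣ a 4 → a 4 ≢ 4 * a 2 →
    card (signedSumset h (+ 0 ∷ map (λ i → + a (2 + i)) (upTo h)))
      ≥ card (signedSumset (h ∸ 1) (map (λ i → + a (2 + i)) (upTo h))) + 2
    × card (signedSumset h (+ 0 ∷ map (λ i → + a (2 + i)) (upTo h)))
      ≥ h * h + 2 * h ∸ 2
lemma2p10 h@(suc (suc (suc n))) (s≤s (s≤s (s≤s z≤n))) a a₂>0 a↑ a₂-odd a₃≡2a₂ 2∣a₄ a₄≢4a₂ =
  subst (λ Z → card (signedSumset h (+ 0 ∷ Z)) ≥ card (signedSumset (h ∸ 1) Z) + 2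
             × card (signedSumset h (+ 0 ∷ Z)) ≥ h * h + 2 * h ∸ 2)
    (sym shifted-upTo)
    ( card-signedSumset-∷-zero B (2 + n) (All.applyUpTo⁺₁ b h (IncreasingBelow-positive a₂>0 b↑))
                                 (length-applyUpTo b h)
    , card-signedSumset≥square b n a₂>0 b↑ a₂-odd a₃≡2a₂ 2∣a₄ a₄≢2a₃ )
  where
  b : ℕ → ℕ
  b i = a (2 + i)

  B : List ℕ
  B = applyUpTo b h

  shifted-upTo : map (λ i → + a (2 + i)) (upTo h) ≡ map +_ B
  shifted-upTo = trans (map-upTo _ h) (sym (map-applyUpTo b +_ h))

  b↑ : IncreasingBelow b h
  b↑ {i} 1+i<h =
    a↑ (2 + i) (s≤s (s≤s z≤n)) (s≤s (s≤s (s≤s (subst (i ≤_) (ℕP.+-comm 1 n) (s≤s⁻¹ (s≤s⁻¹ 1+i<h))))))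

  a₄≢2a₃ : a 4 ≢ 2 * a 3
  a₄≢2a₃ a₄≡2a₃ = a₄≢4a₂ (trans a₄≡2a₃ (trans (cong (2 *_) a₃≡2a₂) (double-double (a 2))))
    where
    double-double : ∀ x → 2 * (2 * x) ≡ 4 * x
    double-double = ℕSolver.solve-∀
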